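{- Let $\mathbf M$ be a cyclic pointed residuated $\mathbf S$-bimodule with point $0$, and let $e_M(y)=\langle 0\backslash_r y,y\rangle$. For all $\langle a,x\rangle\in S\times M$ and $y\in M$, the residuals below exist in the Nagata product $\mathbf S\ltimes\mathbf M$ and equal $$\langle a,x\rangle\backslash e_M(y)=\langle(0*a\vee x)\backslash_r y,\ a\backslash_\ell y\rangle,\qquad e_M(y)/\langle a,x\rangle=\langle y/_\ell(x\vee a*0),\ y/_r a\rangle.$$ Consequently, for $m,n\in(\mathbf S\ltimes\mathbf M)_0$ the residuals $m\backslash\gamma n$ and $\gamma n/m$ exist in $(\mathbf S\ltimes\mathbf M)_0$, where $\gamma\langle b,z\rangle=\langle 0\backslash_r z,z\rangle$; and for $\langle a,x\rangle\in(\mathbf S\ltimes\mathbf M)_0$ they simplify to $\langle a,x\rangle\backslash e_M(y)=\langle x\backslash_r y,a\backslash_\ell y\rangle$ and $e_M(y)/\langle a,x\rangle=\langle y/_\ell x,y/_r a\rangle$.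
   Context: $\mathbf S$ is a posemigroup (poset with isotone associative multiplication), $\mathbf M=\langle M,\vee\rangle$ a join semilattice; elements of $S$ are $a,b$, of $M$ are $x,y,z$. A residuated $\mathbf S$-bimodule: isotone actions $a*x,x*a\in M$ with $(ab)*x=a*(b*x)$, $x*(ab)=(x*a)*b$, $(a*x)*b=a*(x*b)$, distributing over $\vee$, and maps $\backslash_\ell:S\times M\to M$, $/_\ell:M\times M\to S$, $\backslash_r:M\times M\to S$, $/_r:M\times S\to M$ with $x\le a\backslash_\ell y\iff a*x\le y\iff a\le y/_\ell x$ and $x\le y/_r a\iff x*a\le y\iff a\le x\backslash_r y$. Cyclic pointed: $0\in M$ with $a*0=0*a$ for all $a$. The Nagata product $\mathbf S\ltimes\mathbf M$: $S\times M$ with componentwise order and $\langle a,x\rangle\circ\langle b,y\rangle=\langle ab,x*b\vee a*y\rangle$; the restricted Nagata product $(\mathbf S\ltimes\mathbf M)_0$ is its subposemigroup on $\{\langle a,x\rangle:0*a\le x,a*0\le x\}$. A residual $m\backslash n$ (resp. $n/m$) in a posemigroup is the greatest $k$ with $m\cdot k\le n$ (resp. $k\cdot m\le n$). -}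

module Defs where

open import Level using (Level; _⊔_; suc)
open import Data.Product using (_×_; _,_; proj₁; proj₂; Σ)
open import Relation.Binary.Core using (Rel)
open import Relation.Binary.Structures using (IsPartialOrder)
open import Relation.Binary.Lattice.Bundles using (JoinSemilattice)
open import Function.Bundles using (_⇔_)

record Posemigroup c ℓ₁ ℓ₂ : Set (suc (c ⊔ ℓ₁ ⊔ ℓ₂)) where
  infix  4 _≈_ _≤_
  infixl 7 _·_
  field
    Carrier        : Set c
    _≈_            : Rel Carrier ℓ₁
    _≤_            : Rel Carrier ℓ₂
    _·_            : Carrier → Carrier → Carrier
    isPartialOrder : IsPartialOrder _≈_ _≤_
    assoc          : ∀ a b c → (a · b) · c ≈ a · (b · c)
    mono           : ∀ {a a′ b b′} → a ≤ a′ → b ≤ b′ → a · b ≤ a′ · b′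

module _ {c ℓ} {A : Set c} (_≤_ : Rel A ℓ) (_·_ : A → A → A) where

  IsLeftResidual : A → A → A → Set (c ⊔ ℓ)   -- r = m \ n
  IsLeftResidual m n r = ((m · r) ≤ n) × (∀ k → (m · k) ≤ n → k ≤ r)

  IsRightResidual : A → A → A → Set (c ⊔ ℓ)  -- r = n / m
  IsRightResidual m n r = ((r · m) ≤ n) × (∀ k → (k · m) ≤ n → k ≤ r)

record ResidBimodule {c₁ ℓ₁ ℓ₂ c₂ ℓ₃ ℓ₄}
                     (S : Posemigroup c₁ ℓ₁ ℓ₂)
                     (M : JoinSemilattice c₂ ℓ₃ ℓ₄)
                     : Set (c₁ ⊔ ℓ₁ ⊔ ℓ₂ ⊔ c₂ ⊔ ℓ₃ ⊔ ℓ₄) where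
  private
    module S = Posemigroup S
    module M = JoinSemilattice M
  field
    _*ₗ_ : S.Carrier → M.Carrier → M.Carrier
    _*ᵣ_ : M.Carrier → S.Carrier → M.Carrier
    *ₗ-mono : ∀ {a b x y} → a S.≤ b → x M.≤ y → (a *ₗ x) M.≤ (b *ₗ y)
    *ᵣ-mono : ∀ {a b x y} → a S.≤ b → x M.≤ y → (x *ᵣ a) M.≤ (y *ᵣ b)
    assocₗ  : ∀ a b x → ((a S.· b) *ₗ x) M.≈ (a *ₗ (b *ₗ x))
    assocᵣ  : ∀ x a b → (x *ᵣ (a S.· b)) M.≈ ((x *ᵣ a) *ᵣ b)
    assocₘ  : ∀ a x b → ((a *ₗ x) *ᵣ b) M.≈ (a *ₗ (x *ᵣ b))
    distribₗ : ∀ a x y → (a *ₗ (x M.∨ y)) M.≈ ((a *ₗ x) M.∨ (a *ₗ y))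
    distribᵣ : ∀ x y a → ((x M.∨ y) *ᵣ a) M.≈ ((x *ᵣ a) M.∨ (y *ᵣ a))
    _∖ₗ_ : S.Carrier → M.Carrier → M.Carrier
    _/ₗ_ : M.Carrier → M.Carrier → S.Carrier
    _∖ᵣ_ : M.Carrier → M.Carrier → S.Carrier
    _/ᵣ_ : M.Carrier → S.Carrier → M.Carrier
    resₗ₁ : ∀ a x y → (x M.≤ (a ∖ₗ y)) ⇔ ((a *ₗ x) M.≤ y)
    resₗ₂ : ∀ a x y → ((a *ₗ x) M.≤ y) ⇔ (a S.≤ (y /ₗ x))
    resᵣ₁ : ∀ a x y → (x M.≤ (y /ᵣ a)) ⇔ ((x *ᵣ a) M.≤ y)
    resᵣ₂ : ∀ a x y → ((x *ᵣ a) M.≤ y) ⇔ (a S.≤ (x ∖ᵣ y))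

record CyclicPointed {c₁ ℓ₁ ℓ₂ c₂ ℓ₃ ℓ₄}
                     (S : Posemigroup c₁ ℓ₁ ℓ₂)
                     (M : JoinSemilattice c₂ ℓ₃ ℓ₄)
                     : Set (c₁ ⊔ ℓ₁ ⊔ ℓ₂ ⊔ c₂ ⊔ ℓ₃ ⊔ ℓ₄) where
  field
    bimodule : ResidBimodule S M
  open ResidBimodule bimodule public
  field
    𝟘      : JoinSemilattice.Carrier M
    cyclic : ∀ a → JoinSemilattice._≈_ M (a *ₗ 𝟘) (𝟘 *ᵣ a)

module Nagata {c₁ ℓ₁ ℓ₂ c₂ ℓ₃ ℓ₄}
              {S : Posemigroup c₁ ℓ₁ ℓ₂}
              {M : JoinSemilattice c₂ ℓ₃ ℓ₄}
              (P : CyclicPointed S M) where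
  private
    module S = Posemigroup S
    module M = JoinSemilattice M
  open CyclicPointed P

  Elem : Set (c₁ ⊔ c₂)
  Elem = S.Carrier × M.Carrier

  _⊑_ : Elem → Elem → Set (ℓ₂ ⊔ ℓ₄)
  (a , x) ⊑ (b , y) = (a S.≤ b) × (x M.≤ y)

  _∘_ : Elem → Elem → Elem
  (a , x) ∘ (b , y) = (a S.· b) , ((x *ᵣ b) M.∨ (a *ₗ y))

  In₀ : Elem → Set ℓ₄
  In₀ (a , x) = ((𝟘 *ᵣ a) M.≤ x) × ((a *ₗ 𝟘) M.≤ x)

  Elem₀ : Set (c₁ ⊔ c₂ ⊔ ℓ₄)
  Elem₀ = Σ Elem In₀

  _⊑₀_ : Elem₀ → Elem₀ → Set (ℓ₂ ⊔ ℓ₄)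
  m ⊑₀ n = proj₁ m ⊑ proj₁ n

  e : M.Carrier → Elem
  e y = (𝟘 ∖ᵣ y) , y

  γ : Elem → Elem
  γ (b , z) = e z

  IsLeftResidual₀ : Elem₀ → Elem → Elem₀ → Set (c₁ ⊔ c₂ ⊔ ℓ₂ ⊔ ℓ₄)
  IsLeftResidual₀ m n r =
    ((proj₁ m ∘ proj₁ r) ⊑ n) × (∀ (k : Elem₀) → (proj₁ m ∘ proj₁ k) ⊑ n → k ⊑₀ r)

  IsRightResidual₀ : Elem₀ → Elem → Elem₀ → Set (c₁ ⊔ c₂ ⊔ ℓ₂ ⊔ ℓ₄)
  IsRightResidual₀ m n r =
    ((proj₁ r ∘ proj₁ m) ⊑ n) × (∀ (k : Elem₀) → (proj₁ k ∘ proj₁ m) ⊑ n → k ⊑₀ r)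

-- In S ⋉ M the inequality ⟨a,x⟩ ∘ ⟨b,z⟩ ⊑ e_M(y) reads ab ≤ 0 ∖ᵣ y and x*b ∨ a*z ≤ y.
-- The first conjunct is (0*a)*b ≤ y, which combines with x*b ≤ y into (0*a ∨ x)*b ≤ y,
-- so residuation of the module actions turns the whole condition into
-- ⟨b,z⟩ ⊑ ⟨(0*a ∨ x) ∖ᵣ y, a ∖ₗ y⟩: a Galois correspondence, hence a residual. On the
-- right, the cyclic law a*0 = 0*a rewrites 0*(ba) as b*(a*0) and the same argument applies.
-- On (S ⋉ M)₀ the joins collapse to x, and the residuals found satisfy the defining
-- inequalities of (S ⋉ M)₀ again, so they are also the residuals computed there.
{-# OPTIONS --safe #-}
module Submission where

open import Defs
open import Level using (Level)
open import Data.Product using (_×_; _,_; proj₁; Σ)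
open import Data.Product.Algebra using (Σ-assoc)
open import Data.Product.Function.NonDependent.Propositional using (_×-⇔_)
open import Function.Bundles using (_⇔_; mk⇔; Equivalence)
open import Function.Construct.Composition using (_⇔-∘_)
open import Function.Construct.Identity using (⇔-id)
open import Function.Construct.Symmetry using (⇔-sym)
open import Function.Related.Propositional using (module EquationalReasoning)
open import Relation.Binary.Bundles using (Poset)
open import Relation.Binary.Core using (Rel)
open import Relation.Binary.Definitions using (Reflexive)
open import Relation.Binary.Lattice.Bundles using (JoinSemilattice)
open import Relation.Binary.Structures using (IsPartialOrder)
import Relation.Binary.Lattice.Properties.JoinSemilattice as JoinSemilatticeProperties
import Relation.Binary.Reasoning.PartialOrder as PosetReasoning
import Relation.Binary.Reasoning.Setoid as SetoidReasoning

open Equivalence using (to; from)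

module _ {c ℓ} {A : Set c} (_≤_ : Rel A ℓ) (_·_ : A → A → A) (≤-refl : Reflexive _≤_) where

  galois⇒IsLeftResidual : ∀ {m n r} → (∀ k → (m · k) ≤ n ⇔ k ≤ r) →
                          IsLeftResidual _≤_ _·_ m n r
  galois⇒IsLeftResidual {r = r} m·-⊣ = from (m·-⊣ r) ≤-refl , λ k → to (m·-⊣ k)

  galois⇒IsRightResidual : ∀ {m n r} → (∀ k → (k · m) ≤ n ⇔ k ≤ r) →
                           IsRightResidual _≤_ _·_ m n r
  galois⇒IsRightResidual {r = r} ·m-⊣ = from (·m-⊣ r) ≤-refl , λ k → to (·m-⊣ k)

module _ {c ℓ₁ ℓ₂} (M : JoinSemilattice c ℓ₁ ℓ₂) where
  open JoinSemilattice M

  x∨y≤z⇔x≤z×y≤z : ∀ {x y z} → (x ∨ y) ≤ z ⇔ (x ≤ z × y ≤ z)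
  x∨y≤z⇔x≤z×y≤z = mk⇔ (λ p → trans (x≤x∨y _ _) p , trans (y≤x∨y _ _) p)
                       (λ (p , q) → ∨-least p q)

  ≈⇒≤⇔≤ : ∀ {x y z} → x ≈ y → (x ≤ z) ⇔ (y ≤ z)
  ≈⇒≤⇔≤ x≈y = mk⇔ (trans (reflexive (Eq.sym x≈y))) (trans (reflexive x≈y))

module ResidBimoduleProperties {c₁ ℓ₁ ℓ₂ c₂ ℓ₃ ℓ₄ : Level}
         {S : Posemigroup c₁ ℓ₁ ℓ₂} {M : JoinSemilattice c₂ ℓ₃ ℓ₄}
         (B : ResidBimodule S M) where

  open ResidBimodule B
  private
    module S = Posemigroup S
    module M = JoinSemilattice M
  open JoinSemilattice M using (_∨_; _≤_; _≈_)

  S-refl : ∀ {a} → a S.≤ a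
  S-refl = IsPartialOrder.refl S.isPartialOrder

  *ₗ-congʳ : ∀ {a x y} → x ≈ y → (a *ₗ x) ≈ (a *ₗ y)
  *ₗ-congʳ x≈y = M.antisym (*ₗ-mono S-refl (M.reflexive x≈y))
                           (*ₗ-mono S-refl (M.reflexive (M.Eq.sym x≈y)))

  *ᵣ-congˡ : ∀ {a x y} → x ≈ y → (x *ᵣ a) ≈ (y *ᵣ a)
  *ᵣ-congˡ x≈y = M.antisym (*ᵣ-mono S-refl (M.reflexive x≈y))
                           (*ᵣ-mono S-refl (M.reflexive (M.Eq.sym x≈y)))

  ∨*ᵣ≤⇔ : ∀ {v w b y} → ((v ∨ w) *ᵣ b) ≤ y ⇔ ((v *ᵣ b) ≤ y × (w *ᵣ b) ≤ y)
  ∨*ᵣ≤⇔ {v} {w} {b} = x∨y≤z⇔x≤z×y≤z M ⇔-∘ ≈⇒≤⇔≤ M (distribᵣ v w b)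

  *ₗ∨≤⇔ : ∀ {v w b y} → (b *ₗ (v ∨ w)) ≤ y ⇔ ((b *ₗ v) ≤ y × (b *ₗ w) ≤ y)
  *ₗ∨≤⇔ {v} {w} {b} = x∨y≤z⇔x≤z×y≤z M ⇔-∘ ≈⇒≤⇔≤ M (distribₗ b v w)

module NagataResiduals {c₁ ℓ₁ ℓ₂ c₂ ℓ₃ ℓ₄ : Level}
         {S : Posemigroup c₁ ℓ₁ ℓ₂} {M : JoinSemilattice c₂ ℓ₃ ℓ₄}
         (P : CyclicPointed S M) where

  open CyclicPointed P
  open ResidBimoduleProperties bimodule
  open Nagata P
  private
    module S = Posemigroup S
    module M = JoinSemilattice M
  open Posemigroup S using (_·_)
  open JoinSemilattice M using (_∨_; _≤_; _≈_)
  open JoinSemilatticeProperties M using (∨-comm; x≤y⇒x∨y≈y)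

  a*[𝟘*b]≈[𝟘*a]*b : ∀ a b → (a *ₗ (𝟘 *ᵣ b)) ≈ ((𝟘 *ᵣ a) *ᵣ b)
  a*[𝟘*b]≈[𝟘*a]*b a b = begin
    a *ₗ (𝟘 *ᵣ b)   ≈⟨ assocₘ a 𝟘 b ⟨
    (a *ₗ 𝟘) *ᵣ b   ≈⟨ *ᵣ-congˡ (cyclic a) ⟩
    (𝟘 *ᵣ a) *ᵣ b   ∎
    where open SetoidReasoning (Poset.Eq.setoid M.poset)

  [𝟘*b]*a≈b*[a*𝟘] : ∀ a b → ((𝟘 *ᵣ b) *ᵣ a) ≈ (b *ₗ (a *ₗ 𝟘))
  [𝟘*b]*a≈b*[a*𝟘] a b = begin
    (𝟘 *ᵣ b) *ᵣ a   ≈⟨ *ᵣ-congˡ (cyclic b) ⟨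
    (b *ₗ 𝟘) *ᵣ a   ≈⟨ assocₘ b 𝟘 a ⟩
    b *ₗ (𝟘 *ᵣ a)   ≈⟨ *ₗ-congʳ (cyclic a) ⟨
    b *ₗ (a *ₗ 𝟘)   ∎
    where open SetoidReasoning (Poset.Eq.setoid M.poset)

  ·≤𝟘∖ᵣ⇔ˡ : ∀ {a b y} → (a · b) S.≤ (𝟘 ∖ᵣ y) ⇔ ((𝟘 *ᵣ a) *ᵣ b) ≤ y
  ·≤𝟘∖ᵣ⇔ˡ {a} {b} {y} = begin
    (a · b) S.≤ (𝟘 ∖ᵣ y)   ∼⟨ ⇔-sym (resᵣ₂ (a · b) 𝟘 y) ⟩
    𝟘 *ᵣ (a · b) ≤ y       ∼⟨ ≈⇒≤⇔≤ M (assocᵣ 𝟘 a b) ⟩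
    (𝟘 *ᵣ a) *ᵣ b ≤ y      ∎
    where open EquationalReasoning

  ·≤𝟘∖ᵣ⇔ʳ : ∀ {a b y} → (b · a) S.≤ (𝟘 ∖ᵣ y) ⇔ (b *ₗ (a *ₗ 𝟘)) ≤ y
  ·≤𝟘∖ᵣ⇔ʳ {a} {b} {y} = begin
    (b · a) S.≤ (𝟘 ∖ᵣ y)   ∼⟨ ·≤𝟘∖ᵣ⇔ˡ ⟩
    (𝟘 *ᵣ b) *ᵣ a ≤ y      ∼⟨ ≈⇒≤⇔≤ M ([𝟘*b]*a≈b*[a*𝟘] a b) ⟩
    b *ₗ (a *ₗ 𝟘) ≤ y      ∎
    where open EquationalReasoning

  ∘e⊑⇔⊑ˡ : ∀ {a x u y b z} → u ≈ (𝟘 *ᵣ a) ∨ x →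
           (((a , x) ∘ (b , z)) ⊑ e y) ⇔ ((b , z) ⊑ ((u ∖ᵣ y) , (a ∖ₗ y)))
  ∘e⊑⇔⊑ˡ {a} {x} {u} {y} {b} {z} u≈ = begin
    ((a , x) ∘ (b , z)) ⊑ e y
      ≡⟨⟩
    ((a · b) S.≤ (𝟘 ∖ᵣ y) × ((x *ᵣ b) ∨ (a *ₗ z)) ≤ y)
      ∼⟨ ·≤𝟘∖ᵣ⇔ˡ ×-⇔ x∨y≤z⇔x≤z×y≤z M ⟩
    (((𝟘 *ᵣ a) *ᵣ b) ≤ y × ((x *ᵣ b) ≤ y × (a *ₗ z) ≤ y))
      ↔⟨ Σ-assoc ⟨
    ((((𝟘 *ᵣ a) *ᵣ b) ≤ y × (x *ᵣ b) ≤ y) × (a *ₗ z) ≤ y)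
      ∼⟨ ⇔-sym ∨*ᵣ≤⇔ ×-⇔ ⇔-id _ ⟩
    ((((𝟘 *ᵣ a) ∨ x) *ᵣ b) ≤ y × (a *ₗ z) ≤ y)
      ∼⟨ ≈⇒≤⇔≤ M (*ᵣ-congˡ (M.Eq.sym u≈)) ×-⇔ ⇔-id _ ⟩
    ((u *ᵣ b) ≤ y × (a *ₗ z) ≤ y)
      ∼⟨ resᵣ₂ b u y ×-⇔ ⇔-sym (resₗ₁ a z y) ⟩
    (b , z) ⊑ ((u ∖ᵣ y) , (a ∖ₗ y))
      ∎
    where open EquationalReasoning

  ∘e⊑⇔⊑ʳ : ∀ {a x u y b z} → u ≈ x ∨ (a *ₗ 𝟘) →
           (((b , z) ∘ (a , x)) ⊑ e y) ⇔ ((b , z) ⊑ ((y /ₗ u) , (y /ᵣ a)))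
  ∘e⊑⇔⊑ʳ {a} {x} {u} {y} {b} {z} u≈ = begin
    ((b , z) ∘ (a , x)) ⊑ e y
      ≡⟨⟩
    ((b · a) S.≤ (𝟘 ∖ᵣ y) × ((z *ᵣ a) ∨ (b *ₗ x)) ≤ y)
      ∼⟨ ·≤𝟘∖ᵣ⇔ʳ ×-⇔ x∨y≤z⇔x≤z×y≤z M ⟩
    ((b *ₗ (a *ₗ 𝟘)) ≤ y × ((z *ᵣ a) ≤ y × (b *ₗ x) ≤ y))
      ∼⟨ mk⇔ (λ (p , q , r) → (r , p) , q) (λ ((r , p) , q) → p , q , r) ⟩
    (((b *ₗ x) ≤ y × (b *ₗ (a *ₗ 𝟘)) ≤ y) × (z *ᵣ a) ≤ y)
      ∼⟨ ⇔-sym *ₗ∨≤⇔ ×-⇔ ⇔-id _ ⟩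
    ((b *ₗ (x ∨ (a *ₗ 𝟘))) ≤ y × (z *ᵣ a) ≤ y)
      ∼⟨ ≈⇒≤⇔≤ M (*ₗ-congʳ (M.Eq.sym u≈)) ×-⇔ ⇔-id _ ⟩
    ((b *ₗ u) ≤ y × (z *ᵣ a) ≤ y)
      ∼⟨ resₗ₂ b u y ×-⇔ ⇔-sym (resᵣ₁ a z y) ⟩
    (b , z) ⊑ ((y /ₗ u) , (y /ᵣ a))
      ∎
    where open EquationalReasoning

  ⊑-refl : Reflexive _⊑_
  ⊑-refl = S-refl , M.refl

  leftResidual-e : ∀ {a x u} y → u ≈ (𝟘 *ᵣ a) ∨ x →
                   IsLeftResidual _⊑_ _∘_ (a , x) (e y) ((u ∖ᵣ y) , (a ∖ₗ y))
  leftResidual-e y u≈ = galois⇒IsLeftResidual _⊑_ _∘_ ⊑-refl (λ _ → ∘e⊑⇔⊑ˡ u≈)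

  rightResidual-e : ∀ {a x u} y → u ≈ x ∨ (a *ₗ 𝟘) →
                    IsRightResidual _⊑_ _∘_ (a , x) (e y) ((y /ₗ u) , (y /ᵣ a))
  rightResidual-e y u≈ = galois⇒IsRightResidual _⊑_ _∘_ ⊑-refl (λ _ → ∘e⊑⇔⊑ʳ u≈)

  leftResidual-e-In₀ : ∀ {a x} → In₀ (a , x) → ∀ y →
                       IsLeftResidual _⊑_ _∘_ (a , x) (e y) ((x ∖ᵣ y) , (a ∖ₗ y))
  leftResidual-e-In₀ (𝟘a≤x , _) y = leftResidual-e y (M.Eq.sym (x≤y⇒x∨y≈y 𝟘a≤x))

  rightResidual-e-In₀ : ∀ {a x} → In₀ (a , x) → ∀ y →
                        IsRightResidual _⊑_ _∘_ (a , x) (e y) ((y /ₗ x) , (y /ᵣ a))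
  rightResidual-e-In₀ {a} {x} (_ , a𝟘≤x) y =
    rightResidual-e y (M.Eq.sym (M.Eq.trans (∨-comm x (a *ₗ 𝟘)) (x≤y⇒x∨y≈y a𝟘≤x)))

  𝟘*ᵣ≤⇒In₀ : ∀ {b w} → (𝟘 *ᵣ b) ≤ w → In₀ (b , w)
  𝟘*ᵣ≤⇒In₀ {b} 𝟘b≤w = 𝟘b≤w , M.trans (M.reflexive (cyclic b)) 𝟘b≤w

  ∖-In₀ : ∀ {a x} → In₀ (a , x) → ∀ y → In₀ ((x ∖ᵣ y) , (a ∖ₗ y))
  ∖-In₀ {a} {x} (𝟘a≤x , _) y = 𝟘*ᵣ≤⇒In₀ (from (resₗ₁ a (𝟘 *ᵣ b) y) (begin
    a *ₗ (𝟘 *ᵣ b)   ≈⟨ a*[𝟘*b]≈[𝟘*a]*b a b ⟩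
    (𝟘 *ᵣ a) *ᵣ b   ≤⟨ *ᵣ-mono S-refl 𝟘a≤x ⟩
    x *ᵣ b          ≤⟨ from (resᵣ₂ b x y) S-refl ⟩
    y               ∎))
    where b = x ∖ᵣ y
          open PosetReasoning M.poset

  /-In₀ : ∀ {a x} → In₀ (a , x) → ∀ y → In₀ ((y /ₗ x) , (y /ᵣ a))
  /-In₀ {a} {x} (_ , a𝟘≤x) y = 𝟘*ᵣ≤⇒In₀ (from (resᵣ₁ a (𝟘 *ᵣ b) y) (begin
    (𝟘 *ᵣ b) *ᵣ a   ≈⟨ [𝟘*b]*a≈b*[a*𝟘] a b ⟩
    b *ₗ (a *ₗ 𝟘)   ≤⟨ *ₗ-mono S-refl a𝟘≤x ⟩
    b *ₗ x          ≤⟨ from (resₗ₂ b x y) S-refl ⟩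
    y               ∎))
    where b = y /ₗ x
          open PosetReasoning M.poset

  IsLeftResidual⇒IsLeftResidual₀ : ∀ m {n} r →
    IsLeftResidual _⊑_ _∘_ (proj₁ m) n (proj₁ r) → IsLeftResidual₀ m n r
  IsLeftResidual⇒IsLeftResidual₀ _ _ (m∘r⊑n , greatest) = m∘r⊑n , λ k → greatest (proj₁ k)

  IsRightResidual⇒IsRightResidual₀ : ∀ m {n} r →
    IsRightResidual _⊑_ _∘_ (proj₁ m) n (proj₁ r) → IsRightResidual₀ m n r
  IsRightResidual⇒IsRightResidual₀ _ _ (r∘m⊑n , greatest) = r∘m⊑n , λ k → greatest (proj₁ k)

  leftResidual₀-e : ∀ m y → Σ Elem₀ (IsLeftResidual₀ m (e y))
  leftResidual₀-e m@((a , x) , m∈₀) y =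
    r , IsLeftResidual⇒IsLeftResidual₀ m r (leftResidual-e-In₀ m∈₀ y)
    where r = ((x ∖ᵣ y) , (a ∖ₗ y)) , ∖-In₀ m∈₀ y

  rightResidual₀-e : ∀ m y → Σ Elem₀ (IsRightResidual₀ m (e y))
  rightResidual₀-e m@((a , x) , m∈₀) y =
    r , IsRightResidual⇒IsRightResidual₀ m r (rightResidual-e-In₀ m∈₀ y)
    where r = ((y /ₗ x) , (y /ᵣ a)) , /-In₀ m∈₀ y

mainTheorem10 : ∀ {c₁ ℓ₁ ℓ₂ c₂ ℓ₃ ℓ₄ : Level}
    {S : Posemigroup c₁ ℓ₁ ℓ₂} {M : JoinSemilattice c₂ ℓ₃ ℓ₄}
    (P : CyclicPointed S M) →
    let open CyclicPointed P
        open Nagata P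
        open JoinSemilattice M using (_∨_)
    in (∀ a x y →
          IsLeftResidual _⊑_ _∘_ (a , x) (e y)
            ((((𝟘 *ᵣ a) ∨ x) ∖ᵣ y) , (a ∖ₗ y))
        × IsRightResidual _⊑_ _∘_ (a , x) (e y)
            ((y /ₗ (x ∨ (a *ₗ 𝟘))) , (y /ᵣ a)))
     × (∀ (m n : Elem₀) →
          Σ Elem₀ (IsLeftResidual₀ m (γ (proj₁ n)))
        × Σ Elem₀ (IsRightResidual₀ m (γ (proj₁ n))))
     × (∀ a x → In₀ (a , x) → ∀ y →
          IsLeftResidual _⊑_ _∘_ (a , x) (e y) ((x ∖ᵣ y) , (a ∖ₗ y))
        × IsRightResidual _⊑_ _∘_ (a , x) (e y) ((y /ₗ x) , (y /ᵣ a)))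
mainTheorem10 {M = M} P =
    (λ _ _ y → leftResidual-e y Eq.refl , rightResidual-e y Eq.refl)
  , (λ m ((_ , z) , _) → leftResidual₀-e m z , rightResidual₀-e m z)
  , (λ _ _ ax∈₀ y → leftResidual-e-In₀ ax∈₀ y , rightResidual-e-In₀ ax∈₀ y)
  where open NagataResiduals P
        open JoinSemilattice M using (module Eq)
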